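{- Let $\Sigma$ be a monoidal signature and let $n\xrightarrow{\iota}G\xleftarrow{\omega}m$ and $n\xrightarrow{\iota'}G'\xleftarrow{\omega'}m$ be arrows of $\mathsf{DiscCospan}(\mathbf{Hyp}_\Sigma)$. If for every morphism of preordered cartesian bicategories $\mathcal M:\mathsf{DiscCospan}(\mathbf{Hyp}_\Sigma)\to\mathsf{Span}^{\leq}(\mathbf{Set})$ we have $\mathcal M(n\xrightarrow{\iota}G\xleftarrow{\omega}m)\le\mathcal M(n\xrightarrow{\iota'}G'\xleftarrow{\omega'}m)$, then $(n\xrightarrow{\iota}G\xleftarrow{\omega}m)\le(n\xrightarrow{\iota'}G'\xleftarrow{\omega'}m)$ in $\mathsf{DiscCospan}(\mathbf{Hyp}_\Sigma)$.
   Context: A monoidal signature $\Sigma$ is a set of symbols each with an arity $n$ and coarity $m$ ($\Sigma_{n,m}$ those with arity $n$, coarity $m$). A $\Sigma$-hypergraph $G$ is a set $G_V$ of vertices and, for each $R\in\Sigma_{n,m}$, a set $G_R$ with functions $s_R:G_R\to(G_V)^n$, $t_R:G_R\to(G_V)^m$; a morphism $f:G\to G'$ is $f_V:G_V\to G'_V$ and $f_R:G_R\to G'_R$ commuting with sources and targets. $\mathbf{Hyp}_\Sigma$ is the category of finite $\Sigma$-hypergraphs. For a finitely cocomplete $\mathcal C$, $\mathsf{Cospan}^{\leq}(\mathcal C)$ has arrows $X\to Y$ the isomorphism classes of cospans $X\to A\leftarrow Y$, composition by pushout, tensor by coproduct, and $(X\to A\leftarrow Y)\le(X\to B\leftarrow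 Y)$ iff there is an arrow $B\to A$ commuting with the legs. $\mathsf{DiscCospan}(\mathbf{Hyp}_\Sigma)$ is its full subcategory on finite ordinals $n$ (discrete hypergraphs with vertices $\{0,\dots,n-1\}$, no edges); monoid on $X$: $X+X\xrightarrow{[\mathrm{id},\mathrm{id}]}X\xleftarrow{\mathrm{id}}X$ and $0\to X\xleftarrow{\mathrm{id}}X$; comonoid: the reversed cospans. For a finitely complete $\mathcal C$, $\mathsf{Span}^{\leq}(\mathcal C)$ has arrows $X\to Y$ the isomorphism classes of spans $X\leftarrow A\to Y$, composition by pullback, tensor by product, and $(X\leftarrow A\to Y)\le(X\leftarrow B\to Y)$ iff there is an arrow $A\to B$ commuting with the legs; comonoid on $X$: $X\xleftarrow{\mathrm{id}}X\xrightarrow{\langle\mathrm{id},\mathrm{id}\rangle}X\times X$ and $X\xleftarrow{\mathrm{id}}X\to1$; monoid: the reversed spans. A preordered cartesian bicategory is a symmetric monoidal category $(\mathcal B,\oplus,I)$ with preordered hom-sets (composition, $\oplus$ monotone), each object $X$ carrying a monoid $\mu_X,\eta_X$ and comonoid $\delta_X,\varepsilon_X$ forming a special commutative Frobenius bimonoid (in diagrammatic order: $(\delta_X\oplus\mathrm{id});(\mathrm{id}\oplus\mu_X)=\mu_X;\delta_X=(\mathrm{id}\oplus\delta_X);(\mu_X\oplus\mathrm{id})$, $\delta_X;\mu_X=\mathrm{id}_X$), with $\mathrm{id}_X\le\varepsilon_X;\eta_X$, $\eta_X;\varepsilon_X\le\mathrm{id}_I$, $\mathrm{id}_X\le\delta_X;\mu_X$,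 $\mu_X;\delta_X\le\mathrm{id}_{X\oplus X}$, and every arrow $R:X\to Y$ satisfying $R;\delta_Y\le\delta_X;(R\oplus R)$ and $R;\varepsilon_Y\le\varepsilon_X$. A morphism of preordered cartesian bicategories is a monoidal functor preserving the preorders and the monoids and comonoids. -}

module Defs where

open import Data.Nat using (ℕ; zero; suc; _+_)
open import Data.Nat.Properties using (+-assoc; +-identityʳ)
open import Data.Fin using (Fin; splitAt; _↑ˡ_; _↑ʳ_; cast)
open import Data.List using (List; map; length)
open import Data.List.Properties using (length-map)
open import Data.Sum using (_⊎_; inj₁; inj₂; [_,_]′)
open import Data.Product using (Σ; _×_; _,_; proj₁; proj₂)
open import Data.Unit using (⊤; tt)
open import Function using (id; _∘_; const)
open import Relation.Binary.PropositionalEquality using (_≡_; _≗_; trans)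

record Signature : Set₁ where
  field
    Sym  : Set
    ar   : Sym → ℕ
    coar : Sym → ℕ
open Signature public

record Hyp (S : Signature) : Set where
  field
    nV nE   : ℕ
    lab     : Fin nE → Sym S
    src     : Fin nE → List (Fin nV)
    tgt     : Fin nE → List (Fin nV)
    src-len : ∀ e → length (src e) ≡ ar S (lab e)
    tgt-len : ∀ e → length (tgt e) ≡ coar S (lab e)
open Hyp public

record HypHom {S : Signature} (G H : Hyp S) : Set where
  field
    fV       : Fin (nV G) → Fin (nV H)
    fE       : Fin (nE G) → Fin (nE H)
    lab-pres : ∀ e → lab H (fE e) ≡ lab G e
    src-pres : ∀ e → src H (fE e) ≡ map fV (src G e)
    tgt-pres : ∀ e → tgt H (fE e) ≡ map fV (tgt G e)
open HypHom public

record HypIso {S : Signature} (G H : Hyp S) : Set where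
  field
    to   : HypHom G H
    from : HypHom H G
    invV₁ : ∀ x → fV from (fV to x) ≡ x
    invV₂ : ∀ x → fV to (fV from x) ≡ x
    invE₁ : ∀ x → fE from (fE to x) ≡ x
    invE₂ : ∀ x → fE to (fE from x) ≡ x
open HypIso public

disc : {S : Signature} → ℕ → Hyp S
disc k = record
  { nV = k ; nE = 0 ; lab = λ () ; src = λ () ; tgt = λ ()
  ; src-len = λ () ; tgt-len = λ () }

module _ {S : Signature} (G H : Hyp S) where
  private
    labS : Fin (nE G) ⊎ Fin (nE H) → Sym S
    labS (inj₁ e) = lab G e
    labS (inj₂ e) = lab H e
    srcS tgtS : Fin (nE G) ⊎ Fin (nE H) → List (Fin (nV G + nV H))
    srcS (inj₁ e) = map (_↑ˡ nV H) (src G e)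
    srcS (inj₂ e) = map (nV G ↑ʳ_) (src H e)
    tgtS (inj₁ e) = map (_↑ˡ nV H) (tgt G e)
    tgtS (inj₂ e) = map (nV G ↑ʳ_) (tgt H e)
    srcL : ∀ x → length (srcS x) ≡ ar S (labS x)
    srcL (inj₁ e) = trans (length-map _ (src G e)) (src-len G e)
    srcL (inj₂ e) = trans (length-map _ (src H e)) (src-len H e)
    tgtL : ∀ x → length (tgtS x) ≡ coar S (labS x)
    tgtL (inj₁ e) = trans (length-map _ (tgt G e)) (tgt-len G e)
    tgtL (inj₂ e) = trans (length-map _ (tgt H e)) (tgt-len H e)

  _⊕H_ : Hyp S
  _⊕H_ = record
    { nV = nV G + nV H ; nE = nE G + nE H
    ; lab = labS ∘ splitAt (nE G)
    ; src = srcS ∘ splitAt (nE G)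
    ; tgt = tgtS ∘ splitAt (nE G)
    ; src-len = srcL ∘ splitAt (nE G)
    ; tgt-len = tgtL ∘ splitAt (nE G) }

-- DiscCospan(Hyp_Σ): arrows n → m are cospans n → G ← m of hypergraphs
-- with discrete feet (a morphism from a discrete hypergraph is just a
-- vertex map), considered up to isomorphism of cospans (_≅C_).

record Cospan (S : Signature) (n m : ℕ) : Set where
  constructor cospan
  field
    G : Hyp S
    ι : Fin n → Fin (nV G)
    ω : Fin m → Fin (nV G)
open Cospan public

module _ {S : Signature} {n m : ℕ} where
  _≅C_ : Cospan S n m → Cospan S n m → Set
  c ≅C d = Σ (HypIso (G c) (G d)) λ f →
             (fV (to f) ∘ ι c ≗ ι d) × (fV (to f) ∘ ω c ≗ ω d)

  _≤C_ : Cospan S n m → Cospan S n m → Set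
  c ≤C d = Σ (HypHom (G d) (G c)) λ h →
             (fV h ∘ ι d ≗ ι c) × (fV h ∘ ω d ≗ ω c)

-- e is a composite of c and d, i.e. its carrier is a pushout of
-- G c ← m → G d (composition by pushout, characterised by its universal
-- property; the composite is well-defined up to ≅C).
record IsComposite {S : Signature} {n m k : ℕ}
    (c : Cospan S n m) (d : Cospan S m k) (e : Cospan S n k) : Set₁ where
  field
    p : HypHom (G c) (G e)
    q : HypHom (G d) (G e)
    commutes : fV p ∘ ω c ≗ fV q ∘ ι d
    ι-eq : fV p ∘ ι c ≗ ι e
    ω-eq : fV q ∘ ω d ≗ ω e
    universal : (Q : Hyp S) (a : HypHom (G c) Q) (b : HypHom (G d) Q) →
      fV a ∘ ω c ≗ fV b ∘ ι d →
      Σ (HypHom (G e) Q) λ u →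
        ((fV u ∘ fV p ≗ fV a) × (fE u ∘ fE p ≗ fE a) ×
         (fV u ∘ fV q ≗ fV b) × (fE u ∘ fE q ≗ fE b)) ×
        ((u' : HypHom (G e) Q) →
          (fV u' ∘ fV p ≗ fV a) → (fE u' ∘ fE p ≗ fE a) →
          (fV u' ∘ fV q ≗ fV b) → (fE u' ∘ fE q ≗ fE b) →
          (fV u' ≗ fV u) × (fE u' ≗ fE u))

module _ {S : Signature} where
  discC : ∀ {n m} k → (Fin n → Fin k) → (Fin m → Fin k) → Cospan S n m
  discC k f g = cospan (disc k) f g

  idC : ∀ n → Cospan S n n
  idC n = discC n id id

  _⊗C_ : ∀ {n m n' m'} → Cospan S n m → Cospan S n' m' → Cospan S (n + n') (m + m')
  _⊗C_ {n} {m} c d = cospan (G c ⊕H G d)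
    ([ (_↑ˡ nV (G d)) ∘ ι c , (nV (G c) ↑ʳ_) ∘ ι d ]′ ∘ splitAt n)
    ([ (_↑ˡ nV (G d)) ∘ ω c , (nV (G c) ↑ʳ_) ∘ ω d ]′ ∘ splitAt m)

  αC : ∀ n m k → Cospan S ((n + m) + k) (n + (m + k))
  αC n m k = discC (n + (m + k)) (cast (+-assoc n m k)) id

  λC : ∀ n → Cospan S (0 + n) n
  λC n = idC n

  ρC : ∀ n → Cospan S (n + 0) n
  ρC n = discC n (cast (+-identityʳ n)) id

  μC : ∀ n → Cospan S (n + n) n
  μC n = discC n ([ id , id ]′ ∘ splitAt n) id

  ηC : ∀ n → Cospan S 0 n
  ηC n = discC n (λ ()) id

  δC : ∀ n → Cospan S n (n + n)
  δC n = discC n id ([ id , id ]′ ∘ splitAt n)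

  εC : ∀ n → Cospan S n 0
  εC n = discC n id (λ ())

-- Span≤(Set): arrows are spans up to isomorphism of spans (_≅S_)

record Span (X Y : Set) : Set₁ where
  constructor span
  field
    Apex : Set
    l    : Apex → X
    r    : Apex → Y
open Span public

module _ {X Y : Set} where
  _≤S_ : Span X Y → Span X Y → Set
  s ≤S t = Σ (Apex s → Apex t) λ f → (l t ∘ f ≗ l s) × (r t ∘ f ≗ r s)

  _≅S_ : Span X Y → Span X Y → Set
  s ≅S t = Σ (Apex s → Apex t) λ f → Σ (Apex t → Apex s) λ g →
             (∀ a → g (f a) ≡ a) × (∀ b → f (g b) ≡ b) ×
             (l t ∘ f ≗ l s) × (r t ∘ f ≗ r s)

graphS : {X Y : Set} → (X → Y) → Span X Y
graphS f = span _ id f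

idS : (X : Set) → Span X X
idS X = graphS id

_⨾S_ : {X Y Z : Set} → Span X Y → Span Y Z → Span X Z
s ⨾S t = span (Σ (Apex s × Apex t) λ ab → r s (proj₁ ab) ≡ l t (proj₂ ab))
              (λ x → l s (proj₁ (proj₁ x)))
              (λ x → r t (proj₂ (proj₁ x)))
infixl 5 _⨾S_

_⊗S_ : {X Y X' Y' : Set} → Span X Y → Span X' Y' → Span (X × X') (Y × Y')
s ⊗S t = span (Apex s × Apex t)
              (λ x → l s (proj₁ x) , l t (proj₂ x))
              (λ x → r s (proj₁ x) , r t (proj₂ x))
infixl 6 _⊗S_

αS : (X Y Z : Set) → Span ((X × Y) × Z) (X × (Y × Z))
αS X Y Z = graphS (λ x → proj₁ (proj₁ x) , (proj₂ (proj₁ x) , proj₂ x))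

λS : (X : Set) → Span (⊤ × X) X
λS X = graphS proj₂

ρS : (X : Set) → Span (X × ⊤) X
ρS X = graphS proj₁

δS : (X : Set) → Span X (X × X)
δS X = span X id (λ x → x , x)

εS : (X : Set) → Span X ⊤
εS X = span X id (const tt)

μS : (X : Set) → Span (X × X) X
μS X = span X (λ x → x , x) id

ηS : (X : Set) → Span ⊤ X
ηS X = span X (const tt) id

-- Morphisms of preordered cartesian bicategories
--   DiscCospan(Hyp_Σ) → Span≤(Set):
-- a (strong) monoidal functor, well defined on isomorphism classes,
-- preserving the preorder, the monoids and the comonoids.

record Morphism (S : Signature) : Set₁ where
  field
    M₀ : ℕ → Set
    M₁ : ∀ {n m} → Cospan S n m → Span (M₀ n) (M₀ m)
    M-resp : ∀ {n m} {c d : Cospan S n m} → c ≅C d → M₁ c ≅S M₁ d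
    M-id   : ∀ n → M₁ (idC n) ≅S idS (M₀ n)
    M-comp : ∀ {n m k} {c : Cospan S n m} {d : Cospan S m k} {e : Cospan S n k} →
             IsComposite c d e → M₁ e ≅S (M₁ c ⨾S M₁ d)
    M-mono : ∀ {n m} {c d : Cospan S n m} → c ≤C d → M₁ c ≤S M₁ d
    φ  : ∀ n m → Span (M₀ n × M₀ m) (M₀ (n + m))
    φ⁻ : ∀ n m → Span (M₀ (n + m)) (M₀ n × M₀ m)
    φ-inv₁ : ∀ n m → (φ n m ⨾S φ⁻ n m) ≅S idS _
    φ-inv₂ : ∀ n m → (φ⁻ n m ⨾S φ n m) ≅S idS _
    φ₀  : Span ⊤ (M₀ 0)
    φ₀⁻ : Span (M₀ 0) ⊤
    φ₀-inv₁ : (φ₀ ⨾S φ₀⁻) ≅S idS _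
    φ₀-inv₂ : (φ₀⁻ ⨾S φ₀) ≅S idS _
    φ-natural : ∀ {n m n' m'} (c : Cospan S n m) (d : Cospan S n' m') →
      (M₁ c ⊗S M₁ d ⨾S φ m m') ≅S (φ n n' ⨾S M₁ (c ⊗C d))
    φ-assoc : ∀ n m k →
      (φ n m ⊗S idS (M₀ k) ⨾S φ (n + m) k ⨾S M₁ (αC n m k))
        ≅S (αS (M₀ n) (M₀ m) (M₀ k) ⨾S idS (M₀ n) ⊗S φ m k ⨾S φ n (m + k))
    φ-unitˡ : ∀ n → (φ₀ ⊗S idS (M₀ n) ⨾S φ 0 n ⨾S M₁ (λC n)) ≅S λS (M₀ n)
    φ-unitʳ : ∀ n → (idS (M₀ n) ⊗S φ₀ ⨾S φ n 0 ⨾S M₁ (ρC n)) ≅S ρS (M₀ n)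
    M-μ : ∀ n → (φ n n ⨾S M₁ (μC n)) ≅S μS (M₀ n)
    M-η : ∀ n → (φ₀ ⨾S M₁ (ηC n)) ≅S ηS (M₀ n)
    M-δ : ∀ n → (M₁ (δC n) ⨾S φ⁻ n n) ≅S δS (M₀ n)
    M-ε : ∀ n → (M₁ (εC n) ⨾S φ₀⁻) ≅S εS (M₀ n)
open Morphism public

module Submission where

-- The proof uses a single semantics.  For a hypergraph H, the representable
-- morphism Rep H sends n to the n-tuples of vertices of H and a cospan
-- n → K ← m to the span whose apex is the set of homomorphisms K → H, with
-- legs their restrictions to the two feet.  Evaluated at H = G c, the
-- identity of G c is a point over the feet of c, and an inclusion
-- Rep₁ c ≤S Rep₁ c' maps it to a homomorphism G c' → G c over the same
-- feet: precisely a witness of c ≤C c' (Rep-reflects-≤).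
--
-- Since spans are compared up to propositional equality of
-- their apices, homomorphisms K → H are represented by tabulated vertex and
-- edge maps (vectors), which enjoy extensional equality.

open import Defs
open import Data.Nat using (ℕ; _+_)
open import Data.Nat.Properties using (+-assoc; +-identityʳ)
open import Data.Fin using (Fin; splitAt; _↑ˡ_; _↑ʳ_; cast)
open import Data.Fin.Properties using (splitAt-↑ˡ; splitAt-↑ʳ; join-splitAt; cast-involutive)
open import Data.Vec using (Vec; []; lookup; tabulate; _++_; take; drop; allFin)
import Data.Vec as Vec
open import Data.Vec.Properties
  using (lookup∘tabulate; tabulate∘lookup; tabulate-cong; ++-injective; lookup-splitAt;
         lookup-cast₂; take++drop≡id; ++-assoc-eqFree; ++-identityʳ-eqFree)
open import Data.Vec.Relation.Unary.All as All using (All)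
open import Data.Vec.Relation.Unary.All.Properties using (tabulate⁺; tabulate⁻)
import Data.List as List
import Data.List.Properties as List
open import Data.Sum using (inj₁; inj₂; [_,_]′)
open import Data.Sum.Properties using ([,]-∘; [,]-cong)
open import Data.Product using (_×_; _,_; proj₁; proj₂; uncurry)
open import Data.Product.Properties using (×-≡,≡→≡)
open import Data.Unit using (⊤; tt)
open import Function using (id; _∘_; const)
open import Axiom.UniquenessOfIdentityProofs.WithK using (uip)
open import Relation.Binary.PropositionalEquality
open import Relation.Binary.Bundles using (Setoid)
open import Level using (0ℓ; suc)
import Relation.Binary.Reasoning.Setoid as SetoidReasoning

idH : ∀ {S} (K : Hyp S) → HypHom K K
idH K = record
  { fV = id ; fE = id ; lab-pres = λ _ → refl
  ; src-pres = λ e → sym (List.map-id (src K e))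
  ; tgt-pres = λ e → sym (List.map-id (tgt K e)) }

_∘H_ : ∀ {S} {A B C : Hyp S} → HypHom B C → HypHom A B → HypHom A C
g ∘H f = record
  { fV = fV g ∘ fV f ; fE = fE g ∘ fE f
  ; lab-pres = λ e → trans (lab-pres g (fE f e)) (lab-pres f e)
  ; src-pres = λ e → along (src-pres g (fE f e)) (src-pres f e)
  ; tgt-pres = λ e → along (tgt-pres g (fE f e)) (tgt-pres f e) }
  where
  along : ∀ {xs ys zs} → zs ≡ List.map (fV g) ys → ys ≡ List.map (fV f) xs →
          zs ≡ List.map (fV g ∘ fV f) xs
  along {xs} p q = trans p (trans (cong (List.map (fV g)) q) (sym (List.map-∘ xs)))

module Coproduct {S : Signature} (A B : Hyp S) where

  inlH : HypHom A (A ⊕H B)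
  inlH = record { fV = _↑ˡ nV B ; fE = _↑ˡ nE B
                ; lab-pres = labs ; src-pres = srcs ; tgt-pres = tgts }
    where
    labs : ∀ e → lab (A ⊕H B) (e ↑ˡ nE B) ≡ lab A e
    labs e rewrite splitAt-↑ˡ (nE A) e (nE B) = refl
    srcs : ∀ e → src (A ⊕H B) (e ↑ˡ nE B) ≡ List.map (_↑ˡ nV B) (src A e)
    srcs e rewrite splitAt-↑ˡ (nE A) e (nE B) = refl
    tgts : ∀ e → tgt (A ⊕H B) (e ↑ˡ nE B) ≡ List.map (_↑ˡ nV B) (tgt A e)
    tgts e rewrite splitAt-↑ˡ (nE A) e (nE B) = refl

  inrH : HypHom B (A ⊕H B)
  inrH = record { fV = nV A ↑ʳ_ ; fE = nE A ↑ʳ_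
                ; lab-pres = labs ; src-pres = srcs ; tgt-pres = tgts }
    where
    labs : ∀ e → lab (A ⊕H B) (nE A ↑ʳ e) ≡ lab B e
    labs e rewrite splitAt-↑ʳ (nE A) (nE B) e = refl
    srcs : ∀ e → src (A ⊕H B) (nE A ↑ʳ e) ≡ List.map (nV A ↑ʳ_) (src B e)
    srcs e rewrite splitAt-↑ʳ (nE A) (nE B) e = refl
    tgts : ∀ e → tgt (A ⊕H B) (nE A ↑ʳ e) ≡ List.map (nV A ↑ʳ_) (tgt B e)
    tgts e rewrite splitAt-↑ʳ (nE A) (nE B) e = refl

  copairH : {C : Hyp S} → HypHom A C → HypHom B C → HypHom (A ⊕H B) C
  copairH {C} a b = record
    { fV = copairV ; fE = [ fE a , fE b ]′ ∘ splitAt (nE A)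
    ; lab-pres = labs ; src-pres = srcs ; tgt-pres = tgts }
    where
    copairV : Fin (nV A + nV B) → Fin (nV C)
    copairV = [ fV a , fV b ]′ ∘ splitAt (nV A)
    on-inl : ∀ v → fV a v ≡ copairV (v ↑ˡ nV B)
    on-inl v = sym (cong [ fV a , fV b ]′ (splitAt-↑ˡ (nV A) v (nV B)))
    on-inr : ∀ v → fV b v ≡ copairV (nV A ↑ʳ v)
    on-inr v = sym (cong [ fV a , fV b ]′ (splitAt-↑ʳ (nV A) (nV B) v))
    on-list : ∀ {X} (h : X → Fin (nV C)) (j : X → Fin (nV A + nV B)) →
              (∀ v → h v ≡ copairV (j v)) →
              ∀ {ys} xs → ys ≡ List.map h xs → ys ≡ List.map copairV (List.map j xs)
    on-list h j p xs q = trans q (trans (List.map-cong p xs) (List.map-∘ xs))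
    labs : ∀ x → lab C ([ fE a , fE b ]′ (splitAt (nE A) x)) ≡ lab (A ⊕H B) x
    labs x with splitAt (nE A) x
    ... | inj₁ e = lab-pres a e
    ... | inj₂ e = lab-pres b e
    srcs : ∀ x → src C ([ fE a , fE b ]′ (splitAt (nE A) x)) ≡ List.map copairV (src (A ⊕H B) x)
    srcs x with splitAt (nE A) x
    ... | inj₁ e = on-list (fV a) (_↑ˡ nV B) on-inl (src A e) (src-pres a e)
    ... | inj₂ e = on-list (fV b) (nV A ↑ʳ_) on-inr (src B e) (src-pres b e)
    tgts : ∀ x → tgt C ([ fE a , fE b ]′ (splitAt (nE A) x)) ≡ List.map copairV (tgt (A ⊕H B) x)
    tgts x with splitAt (nE A) x
    ... | inj₁ e = on-list (fV a) (_↑ˡ nV B) on-inl (tgt A e) (tgt-pres a e)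
    ... | inj₂ e = on-list (fV b) (nV A ↑ʳ_) on-inr (tgt B e) (tgt-pres b e)

-- An isomorphism of spans with named components.  Unlike the Σ-type _≅S_,
-- its endpoints are inferable, so isomorphisms compose by equational
-- reasoning; isoS converts back to _≅S_.
record _≃_ {X Y : Set} (s t : Span X Y) : Set where
  field
    forth      : Apex s → Apex t
    back       : Apex t → Apex s
    back∘forth : ∀ a → back (forth a) ≡ a
    forth∘back : ∀ b → forth (back b) ≡ b
    l-forth    : ∀ a → l t (forth a) ≡ l s a
    r-forth    : ∀ a → r t (forth a) ≡ r s a
infix 4 _≃_

module _ {X Y : Set} where

  isoS : {s t : Span X Y} → s ≃ t → s ≅S t
  isoS i = forth , back , back∘forth , forth∘back , l-forth , r-forth
    where open _≃_ i

  ≃-refl : {s : Span X Y} → s ≃ s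
  ≃-refl = record { forth = id ; back = id ; back∘forth = λ _ → refl
                  ; forth∘back = λ _ → refl ; l-forth = λ _ → refl ; r-forth = λ _ → refl }

  ≃-sym : {s t : Span X Y} → s ≃ t → t ≃ s
  ≃-sym {s} {t} i = record
    { forth = back ; back = forth ; back∘forth = forth∘back ; forth∘back = back∘forth
    ; l-forth = λ b → trans (sym (l-forth (back b))) (cong (l t) (forth∘back b))
    ; r-forth = λ b → trans (sym (r-forth (back b))) (cong (r t) (forth∘back b)) }
    where open _≃_ i

  ≃-trans : {s t u : Span X Y} → s ≃ t → t ≃ u → s ≃ u
  ≃-trans i j = record
    { forth = J.forth ∘ I.forth ; back = I.back ∘ J.back
    ; back∘forth = λ a → trans (cong I.back (J.back∘forth (I.forth a))) (I.back∘forth a)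
    ; forth∘back = λ c → trans (cong J.forth (I.forth∘back (J.back c))) (J.forth∘back c)
    ; l-forth = λ a → trans (J.l-forth (I.forth a)) (I.l-forth a)
    ; r-forth = λ a → trans (J.r-forth (I.forth a)) (I.r-forth a) }
    where module I = _≃_ i
          module J = _≃_ j

  ≃-setoid : Setoid (suc 0ℓ) 0ℓ
  ≃-setoid = record
    { Carrier = Span X Y ; _≈_ = _≃_
    ; isEquivalence = record { refl = ≃-refl ; sym = ≃-sym ; trans = ≃-trans } }

  module ≃-Reasoning = SetoidReasoning ≃-setoid

  span-cong : ∀ {A} {l₁ l₂ : A → X} {r₁ r₂ : A → Y} → l₁ ≗ l₂ → r₁ ≗ r₂ → span A l₁ r₁ ≃ span A l₂ r₂
  span-cong pl pr = record { forth = id ; back = id ; back∘forth = λ _ → refl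
                           ; forth∘back = λ _ → refl
                           ; l-forth = λ a → sym (pl a) ; r-forth = λ a → sym (pr a) }

  graph-cong : {f g : X → Y} → f ≗ g → graphS f ≃ graphS g
  graph-cong = span-cong (λ _ → refl)

module _ {X Y Z : Set} where

  ⨾-point-≡ : {s : Span X Y} {t : Span Y Z} {x y : Apex (s ⨾S t)} →
              proj₁ x ≡ proj₁ y → x ≡ y
  ⨾-point-≡ {x = ab , p} {y = .ab , q} refl = cong (ab ,_) (uip p q)

  ⨾-congˡ : {s s' : Span X Y} {t : Span Y Z} → s ≃ s' → (s ⨾S t) ≃ (s' ⨾S t)
  ⨾-congˡ {s} {s'} {t} i = record
    { forth = λ { ((a , b) , e) → (forth a , b) , trans (r-forth a) e }
    ; back = λ { ((a , b) , e) → (back a , b) , trans (r-back a) e }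
    ; back∘forth = λ { ((a , b) , _) → ⨾-point-≡ {s = s} {t} (cong (_, b) (back∘forth a)) }
    ; forth∘back = λ { ((a , b) , _) → ⨾-point-≡ {s = s'} {t} (cong (_, b) (forth∘back a)) }
    ; l-forth = λ { ((a , _) , _) → l-forth a }
    ; r-forth = λ _ → refl }
    where
    open _≃_ i
    r-back : ∀ a → r s (back a) ≡ r s' a
    r-back a = trans (sym (r-forth (back a))) (cong (r s') (forth∘back a))

  ⨾-congʳ : {s : Span X Y} {t t' : Span Y Z} → t ≃ t' → (s ⨾S t) ≃ (s ⨾S t')
  ⨾-congʳ {s} {t} {t'} i = record
    { forth = λ { ((a , b) , e) → (a , forth b) , trans e (sym (l-forth b)) }
    ; back = λ { ((a , b) , e) → (a , back b) , trans e (sym (l-back b)) }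
    ; back∘forth = λ { ((a , b) , _) → ⨾-point-≡ {s = s} {t} (cong (a ,_) (back∘forth b)) }
    ; forth∘back = λ { ((a , b) , _) → ⨾-point-≡ {s = s} {t'} (cong (a ,_) (forth∘back b)) }
    ; l-forth = λ _ → refl
    ; r-forth = λ { ((_ , b) , _) → r-forth b } }
    where
    open _≃_ i
    l-back : ∀ b → l t (back b) ≡ l t' b
    l-back b = trans (sym (l-forth (back b))) (cong (l t') (forth∘back b))

  ⨾-graph : (s : Span X Y) (g : Y → Z) → (s ⨾S graphS g) ≃ span (Apex s) (l s) (g ∘ r s)
  ⨾-graph s g = record
    { forth = λ { ((a , _) , _) → a }
    ; back = λ a → (a , r s a) , refl
    ; back∘forth = λ { ((a , _) , refl) → refl }
    ; forth∘back = λ _ → refl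
    ; l-forth = λ _ → refl
    ; r-forth = λ { ((_ , _) , e) → cong g e } }

  graph⨾graph : (f : X → Y) (g : Y → Z) → (graphS f ⨾S graphS g) ≃ graphS (g ∘ f)
  graph⨾graph f g = ⨾-graph (graphS f) g

codiagonal : ∀ n → Fin (n + n) → Fin n
codiagonal n = [ id , id ]′ ∘ splitAt n

-- Vectors as finite functions.  A vector v : Vec A k is the function
-- lookup v : Fin k → A, and vectors have extensional equality (lookup-ext);
-- reindex v f is the precomposition v ∘ f.
module _ {A : Set} where

  reindex : ∀ {k n} → Vec A k → (Fin n → Fin k) → Vec A n
  reindex v f = tabulate (lookup v ∘ f)

  lookup-reindex : ∀ {k n} (v : Vec A k) (f : Fin n → Fin k) i →
                   lookup (reindex v f) i ≡ lookup v (f i)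
  lookup-reindex v f = lookup∘tabulate (lookup v ∘ f)

  lookup-ext : ∀ {n} {u v : Vec A n} → (∀ i → lookup u i ≡ lookup v i) → u ≡ v
  lookup-ext {u = u} {v} p =
    trans (sym (tabulate∘lookup u)) (trans (tabulate-cong p) (tabulate∘lookup v))

  reindex-id : ∀ {n} (v : Vec A n) → reindex v id ≡ v
  reindex-id = tabulate∘lookup

  reindex-cong : ∀ {k n} (v : Vec A k) {f g : Fin n → Fin k} → f ≗ g → reindex v f ≡ reindex v g
  reindex-cong v p = tabulate-cong (cong (lookup v) ∘ p)

  reindex-reindex : ∀ {k m n} (v : Vec A k) (g : Fin m → Fin k) (f : Fin n → Fin m) →
                    reindex (reindex v g) f ≡ reindex v (g ∘ f)
  reindex-reindex v g f = tabulate-cong (lookup-reindex v g ∘ f)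

  reindex-copair : ∀ {k} a {b} (v : Vec A k) (f : Fin a → Fin k) (g : Fin b → Fin k) →
                   reindex v ([ f , g ]′ ∘ splitAt a) ≡ reindex v f ++ reindex v g
  reindex-copair a v f g = lookup-ext λ i → begin
      lookup (reindex v ([ f , g ]′ ∘ splitAt a)) i
    ≡⟨ lookup-reindex v _ i ⟩
      lookup v ([ f , g ]′ (splitAt a i))
    ≡⟨ on-cases (splitAt a i) ⟩
      [ lookup (reindex v f) , lookup (reindex v g) ]′ (splitAt a i)
    ≡⟨ lookup-splitAt a (reindex v f) (reindex v g) i ⟨
      lookup (reindex v f ++ reindex v g) i
    ∎
    where
    open ≡-Reasoning
    on-cases : ∀ x → lookup v ([ f , g ]′ x) ≡ [ lookup (reindex v f) , lookup (reindex v g) ]′ x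
    on-cases (inj₁ j) = sym (lookup-reindex v f j)
    on-cases (inj₂ j) = sym (lookup-reindex v g j)

  reindex-cast : ∀ {k n} .(eq : n ≡ k) (v : Vec A k) → reindex v (cast eq) ≡ Vec.cast (sym eq) v
  reindex-cast eq v = lookup-ext λ i → trans (lookup-reindex v (cast eq) i) (lookup-cast₂ eq v i)

  reindex-codiagonal : ∀ {n} (v : Vec A n) → reindex v (codiagonal n) ≡ v ++ v
  reindex-codiagonal {n} v = trans (reindex-copair n v id id) (cong₂ _++_ (reindex-id v) (reindex-id v))

  copair-restrictions : ∀ a {b} (f : Fin (a + b) → A) →
                        [ f ∘ (_↑ˡ b) , f ∘ (a ↑ʳ_) ]′ ∘ splitAt a ≗ f
  copair-restrictions a {b} f i = trans (sym ([,]-∘ f (splitAt a i))) (cong f (join-splitAt a b i))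

  reindexSpan : ∀ {k n m} → (Fin n → Fin k) → (Fin m → Fin k) → Span (Vec A n) (Vec A m)
  reindexSpan {k} f g = span (Vec A k) (λ v → reindex v f) (λ v → reindex v g)

  unappend : ∀ n {m} → Vec A (n + m) → Vec A n × Vec A m
  unappend n v = take n v , drop n v

  unappend-++ : ∀ {n m} (xs : Vec A n) (ys : Vec A m) → unappend n (xs ++ ys) ≡ (xs , ys)
  unappend-++ {n} xs ys = ×-≡,≡→≡ (++-injective (take n (xs ++ ys)) xs (take++drop≡id n (xs ++ ys)))

-- Following a graph by the span reindexing along a bijection f amounts to
-- reindexing along the inverse g; this handles the coherence isomorphisms,
-- which Rep H sends to reindexings along casts.
graph⨾reindex-bijection : ∀ {A X : Set} {j k} (h : X → Vec A j)
  (f : Fin j → Fin k) (g : Fin k → Fin j) → (∀ i → f (g i) ≡ i) → (∀ i → g (f i) ≡ i) →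
  (graphS h ⨾S reindexSpan f id) ≃ graphS (λ x → reindex (h x) g)
graph⨾reindex-bijection {A} {X} {k = k} h f g fg gf = record
  { forth = λ { ((x , _) , _) → x }
  ; back = λ x → (x , reindex (h x) g) , sym (round-trip (h x) f g gf)
  ; back∘forth = λ { z@((x , _) , _) →
      ⨾-point-≡ {s = graphS h} {reindexSpan f id} (cong (x ,_) (solution z)) }
  ; forth∘back = λ _ → refl
  ; l-forth = λ _ → refl
  ; r-forth = λ { z@((_ , v) , _) → trans (solution z) (sym (reindex-id v)) } }
  where
  round-trip : ∀ {a b} (v : Vec A a) (p : Fin a → Fin b) (q : Fin b → Fin a) → (∀ i → q (p i) ≡ i) →
               reindex (reindex v q) p ≡ v
  round-trip v p q qp = trans (reindex-reindex v q p) (trans (reindex-cong v qp) (reindex-id v))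
  solution : (z : Apex (graphS h ⨾S reindexSpan {A = A} f id)) →
             reindex (h (proj₁ (proj₁ z))) g ≡ proj₂ (proj₁ z)
  solution ((x , v) , e) = trans (cong (λ w → reindex w g) e) (round-trip v g f fg)

-- HomTo K represents
-- HypHom K H by the vectors of its vertex and edge images together with the
-- (proof-irrelevant) preservation conditions; unlike HypHom, two elements
-- are equal as soon as their vertex and edge maps agree pointwise.
module Into {S : Signature} (H : Hyp S) where

  V : Set
  V = Fin (nV H)

  Preserves : (K : Hyp S) → Vec V (nV K) → Vec (Fin (nE H)) (nE K) → Fin (nE K) → Set
  Preserves K vs es e = (lab H (lookup es e) ≡ lab K e)
                      × (src H (lookup es e) ≡ List.map (lookup vs) (src K e))
                      × (tgt H (lookup es e) ≡ List.map (lookup vs) (tgt K e))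

  record HomTo (K : Hyp S) : Set where
    constructor homTo
    field
      vertices  : Vec V (nV K)
      edges     : Vec (Fin (nE H)) (nE K)
      preserves : All (Preserves K vertices edges) (allFin (nE K))
  open HomTo public

  untab : ∀ {K} → HomTo K → HypHom K H
  untab {K} x = record
    { fV = lookup (vertices x) ; fE = lookup (edges x)
    ; lab-pres = λ e → proj₁ (at e)
    ; src-pres = λ e → proj₁ (proj₂ (at e))
    ; tgt-pres = λ e → proj₂ (proj₂ (at e)) }
    where
    at : ∀ e → Preserves K (vertices x) (edges x) e
    at = tabulate⁻ (preserves x)

  tab : ∀ {K} → HypHom K H → HomTo K
  tab {K} h = homTo (tabulate (fV h)) (tabulate (fE h)) (tabulate⁺ λ e →
      trans (cong (lab H) (lookup∘tabulate (fE h) e)) (lab-pres h e)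
    , along (src H) e (src K e) (src-pres h e)
    , along (tgt H) e (tgt K e) (tgt-pres h e))
    where
    along : (incidence : Fin (nE H) → List.List V) (e : Fin (nE K)) (xs : List.List (Fin (nV K))) →
            incidence (fE h e) ≡ List.map (fV h) xs →
            incidence (lookup (tabulate (fE h)) e) ≡ List.map (lookup (tabulate (fV h))) xs
    along incidence e xs p = trans (cong incidence (lookup∘tabulate (fE h) e))
      (trans p (List.map-cong (λ v → sym (lookup∘tabulate (fV h) v)) xs))

  HomTo-ext : ∀ {K} {x y : HomTo K} →
              (∀ i → lookup (vertices x) i ≡ lookup (vertices y) i) →
              (∀ e → lookup (edges x) e ≡ lookup (edges y) e) → x ≡ y
  HomTo-ext {K} {homTo vs es p} {homTo vs' es' p'} pv pe = same (lookup-ext pv) (lookup-ext pe) p'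
    where
    preserves-irrelevant : ∀ {e} (a b : Preserves K vs es e) → a ≡ b
    preserves-irrelevant (a₁ , a₂ , a₃) (b₁ , b₂ , b₃) =
      cong₂ _,_ (uip a₁ b₁) (cong₂ _,_ (uip a₂ b₂) (uip a₃ b₃))
    same : ∀ {vs' es'} → vs ≡ vs' → es ≡ es' →
           (p' : All (Preserves K vs' es') (allFin (nE K))) → homTo vs es p ≡ homTo vs' es' p'
    same refl refl p' = cong (homTo vs es) (All.irrelevant preserves-irrelevant p p')

  tab-≡ : ∀ {K} (h : HypHom K H) (x : HomTo K) →
          fV h ≗ lookup (vertices x) → fE h ≗ lookup (edges x) → tab h ≡ x
  tab-≡ h x pv pe = HomTo-ext (λ i → trans (lookup∘tabulate (fV h) i) (pv i))
                              (λ e → trans (lookup∘tabulate (fE h) e) (pe e))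

  restrict : ∀ {K K'} → HypHom K' K → HomTo K → HomTo K'
  restrict h x = tab (untab x ∘H h)

  vertex-restrict : ∀ {K K'} (h : HypHom K' K) (x : HomTo K) i →
                    lookup (vertices (restrict h x)) i ≡ lookup (vertices x) (fV h i)
  vertex-restrict h x = lookup∘tabulate (lookup (vertices x) ∘ fV h)

  edge-restrict : ∀ {K K'} (h : HypHom K' K) (x : HomTo K) e →
                  lookup (edges (restrict h x)) e ≡ lookup (edges x) (fE h e)
  edge-restrict h x = lookup∘tabulate (lookup (edges x) ∘ fE h)

  restrict-tab : ∀ {K K'} (p : HypHom K' K) (h : HypHom K H) (x : HomTo K') →
                 fV h ∘ fV p ≗ lookup (vertices x) → fE h ∘ fE p ≗ lookup (edges x) →
                 restrict p (tab h) ≡ x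
  restrict-tab p h x pv pe = tab-≡ (untab (tab h) ∘H p) x
    (λ i → trans (lookup∘tabulate (fV h) (fV p i)) (pv i))
    (λ e → trans (lookup∘tabulate (fE h) (fE p e)) (pe e))

  restrict-inverse : ∀ {A B} (f : HypHom A B) (g : HypHom B A) →
                     fV g ∘ fV f ≗ id → fE g ∘ fE f ≗ id →
                     ∀ x → restrict f (restrict g x) ≡ x
  restrict-inverse f g gfV gfE x = HomTo-ext
    (λ i → trans (vertex-restrict f (restrict g x) i)
                 (trans (vertex-restrict g x (fV f i)) (cong (lookup (vertices x)) (gfV i))))
    (λ e → trans (edge-restrict f (restrict g x) e)
                 (trans (edge-restrict g x (fE f e)) (cong (lookup (edges x)) (gfE e))))

  foot : ∀ {K n} → HomTo K → (Fin n → Fin (nV K)) → Vec V n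
  foot x f = reindex (vertices x) f

  foot-restrict : ∀ {K K' n} (h : HypHom K' K) (x : HomTo K) {f : Fin n → Fin (nV K')}
                  {g : Fin n → Fin (nV K)} → fV h ∘ f ≗ g → foot (restrict h x) f ≡ foot x g
  foot-restrict h x {f} hf≗g =
    trans (reindex-reindex (vertices x) (fV h) f) (reindex-cong (vertices x) hf≗g)

  foot-pointwise : ∀ {K K' n} {x : HomTo K} {y : HomTo K'} {f : Fin n → Fin (nV K)}
                   {g : Fin n → Fin (nV K')} → foot x f ≡ foot y g →
                   lookup (vertices x) ∘ f ≗ lookup (vertices y) ∘ g
  foot-pointwise {x = x} {y} {f} {g} eq i =
    trans (sym (lookup-reindex (vertices x) f i))
          (trans (cong (λ v → lookup v i) eq) (lookup-reindex (vertices y) g i))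

  module _ (A B : Hyp S) where
    open Coproduct A B

    unpair : HomTo (A ⊕H B) → HomTo A × HomTo B
    unpair x = restrict inlH x , restrict inrH x

    pair : HomTo A × HomTo B → HomTo (A ⊕H B)
    pair (a , b) = tab (copairH (untab a) (untab b))

    unpair-pair : ∀ ab → unpair (pair ab) ≡ ab
    unpair-pair (a , b) = cong₂ _,_
      (restrict-tab inlH (copairH (untab a) (untab b)) a
        (λ i → cong [ lookup (vertices a) , lookup (vertices b) ]′ (splitAt-↑ˡ (nV A) i (nV B)))
        (λ e → cong [ lookup (edges a) , lookup (edges b) ]′ (splitAt-↑ˡ (nE A) e (nE B))))
      (restrict-tab inrH (copairH (untab a) (untab b)) b
        (λ i → cong [ lookup (vertices a) , lookup (vertices b) ]′ (splitAt-↑ʳ (nV A) (nV B) i))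
        (λ e → cong [ lookup (edges a) , lookup (edges b) ]′ (splitAt-↑ʳ (nE A) (nE B) e)))

    pair-unpair : ∀ x → pair (unpair x) ≡ x
    pair-unpair x = tab-≡ (copairH (untab (restrict inlH x)) (untab (restrict inrH x))) x
      (λ i → trans ([,]-cong (vertex-restrict inlH x) (vertex-restrict inrH x) (splitAt (nV A) i))
                   (copair-restrictions (nV A) (lookup (vertices x)) i))
      (λ e → trans ([,]-cong (edge-restrict inlH x) (edge-restrict inrH x) (splitAt (nE A) e))
                   (copair-restrictions (nE A) (lookup (edges x)) e))

    foot-⊕ : ∀ {a b} (x : HomTo (A ⊕H B)) (f : Fin a → Fin (nV A)) (g : Fin b → Fin (nV B)) →
             foot x ([ (_↑ˡ nV B) ∘ f , (nV A ↑ʳ_) ∘ g ]′ ∘ splitAt a)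
               ≡ foot (proj₁ (unpair x)) f ++ foot (proj₂ (unpair x)) g
    foot-⊕ {a} x f g = trans (reindex-copair a (vertices x) _ _)
      (cong₂ _++_ (sym (foot-restrict inlH x {f} (λ _ → refl)))
                  (sym (foot-restrict inrH x {g} (λ _ → refl))))

module Representable {S : Signature} (H : Hyp S) where
  open Into H

  Rep₀ : ℕ → Set
  Rep₀ = Vec V

  Rep₁ : ∀ {n m} → Cospan S n m → Span (Rep₀ n) (Rep₀ m)
  Rep₁ c = span (HomTo (G c)) (λ x → foot x (ι c)) (λ x → foot x (ω c))

  Rep-mono : ∀ {n m} {c d : Cospan S n m} → c ≤C d → Rep₁ c ≤S Rep₁ d
  Rep-mono (h , hι , hω) = restrict h , (λ x → foot-restrict h x hι) , (λ x → foot-restrict h x hω)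

  Rep-resp : ∀ {n m} {c d : Cospan S n m} → c ≅C d → Rep₁ c ≃ Rep₁ d
  Rep-resp {c = c} (i , eι , eω) = record
    { forth = restrict (from i) ; back = restrict (to i)
    ; back∘forth = restrict-inverse (to i) (from i) (invV₁ i) (invE₁ i)
    ; forth∘back = restrict-inverse (from i) (to i) (invV₂ i) (invE₂ i)
    ; l-forth = λ x → foot-restrict (from i) x (back-along (ι c) eι)
    ; r-forth = λ x → foot-restrict (from i) x (back-along (ω c) eω) }
    where
    back-along : ∀ {k} (f : Fin k → Fin (nV (G c))) {g} → fV (to i) ∘ f ≗ g → fV (from i) ∘ g ≗ f
    back-along f p j = trans (cong (fV (from i)) (sym (p j))) (invV₁ i (f j))

  -- a homomorphism out of a discrete hypergraph is just a tuple of vertices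
  Rep-disc : ∀ {n m} K (f : Fin n → Fin K) (g : Fin m → Fin K) →
             Rep₁ (discC K f g) ≃ reindexSpan f g
  Rep-disc K f g = record
    { forth = vertices ; back = λ v → homTo v [] All.[]
    ; back∘forth = λ { (homTo v [] All.[]) → refl } ; forth∘back = λ _ → refl
    ; l-forth = λ _ → refl ; r-forth = λ _ → refl }

  Rep-id : ∀ n → Rep₁ (idC n) ≃ idS (Rep₀ n)
  Rep-id n = ≃-trans (Rep-disc n id id) (span-cong reindex-id reindex-id)

  -- A homomorphism out of a pushout is the same as a compatible pair of
  -- homomorphisms out of its two components (the universal property).
  Rep-comp : ∀ {n m k} {c : Cospan S n m} {d : Cospan S m k} {e : Cospan S n k} →
             IsComposite c d e → Rep₁ e ≃ (Rep₁ c ⨾S Rep₁ d)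
  Rep-comp {c = c} {d} {e} ic = record
    { forth = split ; back = glue
    ; back∘forth = glue∘split ; forth∘back = split∘glue
    ; l-forth = λ x → foot-restrict p x ι-eq
    ; r-forth = λ x → foot-restrict q x ω-eq }
    where
    open IsComposite ic
    Pair : Set
    Pair = Apex (Rep₁ c ⨾S Rep₁ d)
    split : HomTo (G e) → Pair
    split x = (restrict p x , restrict q x) ,
              trans (foot-restrict p x commutes) (sym (foot-restrict q x (λ _ → refl)))
    compatible : (ab : Pair) → fV (untab (proj₁ (proj₁ ab))) ∘ ω c ≗ fV (untab (proj₂ (proj₁ ab))) ∘ ι d
    compatible ((a , b) , agree) = foot-pointwise {x = a} {b} agree
    mediator : Pair → HypHom (G e) H
    mediator ab@((a , b) , _) = proj₁ (universal H (untab a) (untab b) (compatible ab))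
    Factors : HypHom (G e) H → Pair → Set
    Factors u ((a , b) , _) =
      (fV u ∘ fV p ≗ lookup (vertices a)) × (fE u ∘ fE p ≗ lookup (edges a)) ×
      (fV u ∘ fV q ≗ lookup (vertices b)) × (fE u ∘ fE q ≗ lookup (edges b))
    factors : ∀ ab → Factors (mediator ab) ab
    factors ab@((a , b) , _) = proj₁ (proj₂ (universal H (untab a) (untab b) (compatible ab)))
    glue : Pair → HomTo (G e)
    glue ab = tab (mediator ab)
    -- x itself factors its restrictions, hence is the mediator
    unique : ∀ x → (lookup (vertices x) ≗ fV (mediator (split x)))
                 × (lookup (edges x) ≗ fE (mediator (split x)))
    unique x = proj₂ (proj₂ (universal H (untab (restrict p x)) (untab (restrict q x))
                                         (compatible (split x)))) (untab x)
      (λ i → sym (vertex-restrict p x i)) (λ i → sym (edge-restrict p x i))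
      (λ i → sym (vertex-restrict q x i)) (λ i → sym (edge-restrict q x i))
    glue∘split : ∀ x → glue (split x) ≡ x
    glue∘split x = tab-≡ (mediator (split x)) x
      (λ i → sym (proj₁ (unique x) i)) (λ e → sym (proj₂ (unique x) e))
    split∘glue : ∀ ab → split (glue ab) ≡ ab
    split∘glue ab@((a , b) , _) with factors ab
    ... | onV-a , onE-a , onV-b , onE-b = ⨾-point-≡ {s = Rep₁ c} {Rep₁ d}
      (cong₂ _,_ (restrict-tab p (mediator ab) a onV-a onE-a)
                 (restrict-tab q (mediator ab) b onV-b onE-b))

  φR : ∀ n m → Span (Rep₀ n × Rep₀ m) (Rep₀ (n + m))
  φR n m = graphS (uncurry _++_)

  φR⁻ : ∀ n m → Span (Rep₀ (n + m)) (Rep₀ n × Rep₀ m)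
  φR⁻ n m = graphS (unappend n)

  φR₀ : Span ⊤ (Rep₀ 0)
  φR₀ = graphS (const [])

  φR₀⁻ : Span (Rep₀ 0) ⊤
  φR₀⁻ = graphS (const tt)

  φR-inv₁ : ∀ n m → (φR n m ⨾S φR⁻ n m) ≃ idS (Rep₀ n × Rep₀ m)
  φR-inv₁ n m = ≃-trans (graph⨾graph _ _) (graph-cong (uncurry unappend-++))

  φR-inv₂ : ∀ n m → (φR⁻ n m ⨾S φR n m) ≃ idS (Rep₀ (n + m))
  φR-inv₂ n m = ≃-trans (graph⨾graph _ _) (graph-cong (take++drop≡id n))

  φR₀-inv₁ : (φR₀ ⨾S φR₀⁻) ≃ idS ⊤
  φR₀-inv₁ = graph⨾graph (const []) (const tt)

  φR₀-inv₂ : (φR₀⁻ ⨾S φR₀) ≃ idS (Rep₀ 0)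
  φR₀-inv₂ = ≃-trans (graph⨾graph _ _) (graph-cong λ { [] → refl })

  -- Naturality of φR: both composites are the span of pairs of
  -- homomorphisms, because homomorphisms out of G c ⊕H G d are such pairs.
  module _ {n m n' m'} (c : Cospan S n m) (d : Cospan S n' m') where

    PairSpan : Span (Rep₀ n × Rep₀ n') (Rep₀ (m + m'))
    PairSpan = span (HomTo (G c) × HomTo (G d))
                    (λ (a , b) → foot a (ι c) , foot b (ι d))
                    (λ (a , b) → foot a (ω c) ++ foot b (ω d))

    tensor-then-φ : (Rep₁ c ⊗S Rep₁ d ⨾S φR m m') ≃ PairSpan
    tensor-then-φ = ⨾-graph (Rep₁ c ⊗S Rep₁ d) (uncurry _++_)

    φ-then-tensor : (φR n n' ⨾S Rep₁ (c ⊗C d)) ≃ PairSpan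
    φ-then-tensor = record
      { forth = λ z → unpair (G c) (G d) (proj₂ (proj₁ z))
      ; back = λ ab → ((foot (proj₁ ab) (ι c) , foot (proj₂ ab) (ι d)) , pair (G c) (G d) ab) ,
          sym (trans (foot-⊕ (G c) (G d) (pair (G c) (G d) ab) (ι c) (ι d))
                     (cong (λ (a , b) → foot a (ι c) ++ foot b (ι d)) (unpair-pair (G c) (G d) ab)))
      ; back∘forth = λ z → ⨾-point-≡ {s = φR n n'} {Rep₁ (c ⊗C d)}
          (cong₂ _,_ (inputs z) (pair-unpair (G c) (G d) (proj₂ (proj₁ z))))
      ; forth∘back = unpair-pair (G c) (G d)
      ; l-forth = inputs
      ; r-forth = λ z → sym (foot-⊕ (G c) (G d) (proj₂ (proj₁ z)) (ω c) (ω d)) }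
      where
      inputs : (z : Apex (φR n n' ⨾S Rep₁ (c ⊗C d))) →
               l PairSpan (unpair (G c) (G d) (proj₂ (proj₁ z))) ≡ proj₁ (proj₁ z)
      inputs (((xs , ys) , x) , e) =
        sym (×-≡,≡→≡ (++-injective xs _ (trans e (foot-⊕ (G c) (G d) x (ι c) (ι d)))))

    φR-natural : (Rep₁ c ⊗S Rep₁ d ⨾S φR m m') ≃ (φR n n' ⨾S Rep₁ (c ⊗C d))
    φR-natural = ≃-trans tensor-then-φ (≃-sym φ-then-tensor)

  -- Coherence with the associator and unitors: the structural cospans are
  -- discrete, given by casts, so Rep H sends them to reindexings along casts.
  module _ {X : Set} {j k} (h : X → Vec V j) (eq : j ≡ k) where
    graph⨾cast : (graphS h ⨾S Rep₁ (discC k (cast eq) id)) ≃ graphS (Vec.cast eq ∘ h)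
    graph⨾cast = begin
        graphS h ⨾S Rep₁ (discC k (cast eq) id)
      ≈⟨ ⨾-congʳ (Rep-disc k (cast eq) id) ⟩
        graphS h ⨾S reindexSpan (cast eq) id
      ≈⟨ graph⨾reindex-bijection h (cast eq) (cast (sym eq))
           (cast-involutive eq (sym eq)) (cast-involutive (sym eq) eq) ⟩
        graphS (λ x → reindex (h x) (cast (sym eq)))
      ≈⟨ graph-cong (λ x → reindex-cast (sym eq) (h x)) ⟩
        graphS (Vec.cast eq ∘ h)
      ∎
      where open ≃-Reasoning

  φR-assoc : ∀ n m k →
    (φR n m ⊗S idS (Rep₀ k) ⨾S φR (n + m) k ⨾S Rep₁ (αC n m k))
      ≃ (αS (Rep₀ n) (Rep₀ m) (Rep₀ k) ⨾S idS (Rep₀ n) ⊗S φR m k ⨾S φR n (m + k))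
  φR-assoc n m k = begin
      φR n m ⊗S idS (Rep₀ k) ⨾S φR (n + m) k ⨾S Rep₁ (αC n m k)
    ≈⟨ ⨾-congˡ (⨾-graph (φR n m ⊗S idS (Rep₀ k)) (uncurry _++_)) ⟩
      graphS concatˡ ⨾S Rep₁ (αC n m k)
    ≈⟨ graph⨾cast concatˡ (+-assoc n m k) ⟩
      graphS (Vec.cast (+-assoc n m k) ∘ concatˡ)
    ≈⟨ graph-cong (λ ((xs , ys) , zs) → ++-assoc-eqFree xs ys zs) ⟩
      graphS concatʳ
    ≈⟨ graph⨾graph (λ ((xs , ys) , zs) → xs , ys ++ zs) (uncurry _++_) ⟨
      graphS (λ ((xs , ys) , zs) → xs , ys ++ zs) ⨾S φR n (m + k)
    ≈⟨ ⨾-congˡ (graph⨾graph (λ ((xs , ys) , zs) → xs , (ys , zs))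
                            (λ (xs , yzs) → xs , uncurry _++_ yzs)) ⟨
      αS (Rep₀ n) (Rep₀ m) (Rep₀ k) ⨾S idS (Rep₀ n) ⊗S φR m k ⨾S φR n (m + k)
    ∎
    where
    open ≃-Reasoning
    concatˡ : (Rep₀ n × Rep₀ m) × Rep₀ k → Rep₀ ((n + m) + k)
    concatˡ ((xs , ys) , zs) = (xs ++ ys) ++ zs
    concatʳ : (Rep₀ n × Rep₀ m) × Rep₀ k → Rep₀ (n + (m + k))
    concatʳ ((xs , ys) , zs) = xs ++ (ys ++ zs)

  φR-unitˡ : ∀ n → (φR₀ ⊗S idS (Rep₀ n) ⨾S φR 0 n ⨾S Rep₁ (λC n)) ≃ λS (Rep₀ n)
  φR-unitˡ n = begin
      φR₀ ⊗S idS (Rep₀ n) ⨾S φR 0 n ⨾S Rep₁ (λC n)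
    ≈⟨ ⨾-congˡ (⨾-graph (φR₀ ⊗S idS (Rep₀ n)) (uncurry _++_)) ⟩
      graphS proj₂ ⨾S Rep₁ (idC n)
    ≈⟨ ⨾-congʳ (Rep-id n) ⟩
      graphS proj₂ ⨾S idS (Rep₀ n)
    ≈⟨ graph⨾graph proj₂ id ⟩
      λS (Rep₀ n)
    ∎
    where open ≃-Reasoning

  φR-unitʳ : ∀ n → (idS (Rep₀ n) ⊗S φR₀ ⨾S φR n 0 ⨾S Rep₁ (ρC n)) ≃ ρS (Rep₀ n)
  φR-unitʳ n = begin
      idS (Rep₀ n) ⊗S φR₀ ⨾S φR n 0 ⨾S Rep₁ (ρC n)
    ≈⟨ ⨾-congˡ (⨾-graph (idS (Rep₀ n) ⊗S φR₀) (uncurry _++_)) ⟩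
      graphS (λ (xs , _) → xs ++ []) ⨾S Rep₁ (ρC n)
    ≈⟨ graph⨾cast (λ (xs , _) → xs ++ []) (+-identityʳ n) ⟩
      graphS (λ (xs , _) → Vec.cast (+-identityʳ n) (xs ++ []))
    ≈⟨ graph-cong (λ (xs , _) → ++-identityʳ-eqFree xs) ⟩
      ρS (Rep₀ n)
    ∎
    where open ≃-Reasoning

  Rep-μ : ∀ n → (φR n n ⨾S Rep₁ (μC n)) ≃ μS (Rep₀ n)
  Rep-μ n = ≃-trans (⨾-congʳ (Rep-disc n (codiagonal n) id)) record
    { forth = λ z → proj₂ (proj₁ z)
    ; back = λ v → ((v , v) , v) , sym (reindex-codiagonal v)
    ; back∘forth = λ z → ⨾-point-≡ {s = φR n n} {reindexSpan (codiagonal n) id}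
                           (cong (_, proj₂ (proj₁ z)) (duplicate z))
    ; forth∘back = λ _ → refl
    ; l-forth = duplicate
    ; r-forth = λ z → sym (reindex-id (proj₂ (proj₁ z))) }
    where
    duplicate : (z : Apex (φR n n ⨾S reindexSpan (codiagonal n) id)) →
                (proj₂ (proj₁ z) , proj₂ (proj₁ z)) ≡ proj₁ (proj₁ z)
    duplicate (((xs , ys) , v) , e) =
      sym (×-≡,≡→≡ (++-injective xs v (trans e (reindex-codiagonal v))))

  Rep-η : ∀ n → (φR₀ ⨾S Rep₁ (ηC n)) ≃ ηS (Rep₀ n)
  Rep-η n = ≃-trans (⨾-congʳ (Rep-disc n (λ ()) id)) record
    { forth = λ z → proj₂ (proj₁ z)
    ; back = λ v → (tt , v) , refl
    ; back∘forth = λ _ → ⨾-point-≡ {s = φR₀} {reindexSpan (λ ()) id} refl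
    ; forth∘back = λ _ → refl
    ; l-forth = λ _ → refl
    ; r-forth = λ z → sym (reindex-id (proj₂ (proj₁ z))) }

  Rep-δ : ∀ n → (Rep₁ (δC n) ⨾S φR⁻ n n) ≃ δS (Rep₀ n)
  Rep-δ n = ≃-trans (⨾-congˡ (Rep-disc n id (codiagonal n)))
    (≃-trans (⨾-graph (reindexSpan id (codiagonal n)) (unappend n))
    (span-cong reindex-id (λ v → trans (cong (unappend n) (reindex-codiagonal v)) (unappend-++ v v))))

  Rep-ε : ∀ n → (Rep₁ (εC n) ⨾S φR₀⁻) ≃ εS (Rep₀ n)
  Rep-ε n = ≃-trans (⨾-congˡ (Rep-disc n id (λ ())))
    (≃-trans (⨾-graph (reindexSpan id (λ ())) (const tt))
    (span-cong reindex-id (λ _ → refl)))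

  Rep : Morphism S
  Rep = record
    { M₀ = Rep₀ ; M₁ = Rep₁
    ; M-resp = isoS ∘ Rep-resp ; M-id = isoS ∘ Rep-id ; M-comp = isoS ∘ Rep-comp ; M-mono = Rep-mono
    ; φ = φR ; φ⁻ = φR⁻
    ; φ-inv₁ = λ n m → isoS (φR-inv₁ n m) ; φ-inv₂ = λ n m → isoS (φR-inv₂ n m)
    ; φ₀ = φR₀ ; φ₀⁻ = φR₀⁻
    ; φ₀-inv₁ = isoS φR₀-inv₁ ; φ₀-inv₂ = isoS φR₀-inv₂
    ; φ-natural = λ c d → isoS (φR-natural c d)
    ; φ-assoc = λ n m k → isoS (φR-assoc n m k)
    ; φ-unitˡ = isoS ∘ φR-unitˡ ; φ-unitʳ = isoS ∘ φR-unitʳ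
    ; M-μ = isoS ∘ Rep-μ ; M-η = isoS ∘ Rep-η ; M-δ = isoS ∘ Rep-δ ; M-ε = isoS ∘ Rep-ε }

-- Yoneda: evaluated at the carrier of c, the representable semantics
-- reflects the order.  The identity of G c lies over the feet of c, and its
-- image under Rep₁ c ≤S Rep₁ d is a homomorphism G d → G c over the same feet.
Rep-reflects-≤ : ∀ {S n m} (c d : Cospan S n m) →
                 Representable.Rep₁ (G c) c ≤S Representable.Rep₁ (G c) d → c ≤C d
Rep-reflects-≤ c d (f , fι , fω) = untab (f identity) , over (fι identity) , over (fω identity)
  where
  open Into (G c)
  identity : HomTo (G c)
  identity = tab (idH (G c))
  over : ∀ {k} {g : Fin k → Fin (nV (G d))} {g' : Fin k → Fin (nV (G c))} →
         foot (f identity) g ≡ foot identity g' → lookup (vertices (f identity)) ∘ g ≗ g'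
  over {g' = g'} eq i =
    trans (foot-pointwise {x = f identity} {identity} eq i) (lookup∘tabulate id (g' i))

mainTheorem3 : (S : Signature) {n m : ℕ} (c c' : Cospan S n m) →
               ((M : Morphism S) → M₁ M c ≤S M₁ M c') →
               c ≤C c'
mainTheorem3 S c c' ordered-everywhere =
  Rep-reflects-≤ c c' (ordered-everywhere (Representable.Rep (G c)))
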